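{- For any graph $G$ and any $n\ge1$, $\gamma(P_n\square G)\le \gamma(G)(2^n-1)$, where $P_n$ is the path on $n$ vertices.
   Context: All graphs are finite and connected. A pebbling step removes two pebbles from a vertex and places one pebble on an adjacent vertex. The cover pebbling number $\gamma(G)$ is the minimum number $N$ such that for every placement of $N$ pebbles on the vertices of $G$ there is a sequence of pebbling steps after which every vertex has at least one pebble. $G\square H$ denotes the Cartesian product of graphs: vertex set $V(G)\times V(H)$, with $(w,v)\sim(w',v')$ iff ($w=w'$ and $v\sim v'$ in $H$) or ($v=v'$ and $w\sim w'$ in $G$). -}

module Defs where

open import Level using (0ℓ)
open import Data.Nat using (ℕ; zero; suc; _+_; _*_; _∸_; _^_; _≤_)
open import Data.Fin using (Fin; toℕ)
open import Data.List using (List; map; allFin; cartesianProduct)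
open import Data.Nat.ListAction using (sum)
open import Data.List.Membership.Propositional using (_∈_)
open import Data.List.Relation.Unary.Unique.Propositional using (Unique)
open import Data.Product using (_×_; _,_; Σ; ∃)
open import Data.Sum using (_⊎_)
open import Relation.Nullary using (¬_)
open import Relation.Binary.PropositionalEquality using (_≡_; _≢_)
open import Relation.Binary.Construct.Closure.ReflexiveTransitive using (Star)

record Graph : Set₁ where
  field
    V     : Set
    _~_   : V → V → Set
    verts : List V
open Graph public

record IsFiniteSimpleConnected (G : Graph) : Set where
  field
    complete   : ∀ v → v ∈ verts G
    unique     : Unique (verts G)
    symmetric  : ∀ {u v} → _~_ G u v → _~_ G v u
    irreflexive : ∀ {v} → ¬ (_~_ G v v)
    connected  : ∀ u v → Star (_~_ G) u v

Path : ℕ → Graph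
Path n = record
  { V = Fin n
  ; _~_ = λ i j → (toℕ j ≡ suc (toℕ i)) ⊎ (toℕ i ≡ suc (toℕ j))
  ; verts = allFin n
  }

_□_ : Graph → Graph → Graph
G □ H = record
  { V = V G × V H
  ; _~_ = λ { (w , v) (w' , v') →
        (w ≡ w' × _~_ H v v') ⊎ (v ≡ v' × _~_ G w w') }
  ; verts = cartesianProduct (verts G) (verts H)
  }

Distribution : Graph → Set
Distribution G = V G → ℕ

size : (G : Graph) → Distribution G → ℕ
size G d = sum (map d (verts G))

PebblingStep : (G : Graph) → Distribution G → Distribution G → Set
PebblingStep G d d' =
  Σ (V G) λ u → Σ (V G) λ v →
    _~_ G u v ×
    (d' u + 2 ≡ d u) ×
    (d' v ≡ d v + 1) ×
    (∀ w → w ≢ u → w ≢ v → d' w ≡ d w)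

Reachable : (G : Graph) → Distribution G → Distribution G → Set
Reachable G = Star (PebblingStep G)

IsCover : (G : Graph) → Distribution G → Set
IsCover G d = ∀ v → 1 ≤ d v

CoverSolvable : Graph → ℕ → Set
CoverSolvable G N =
  ∀ (d : Distribution G) → size G d ≡ N →
    ∃ λ d' → Reachable G d d' × IsCover G d'

IsCoverPebblingNumber : Graph → ℕ → Set
IsCoverPebblingNumber G γ =
  CoverSolvable G γ × (∀ N → CoverSolvable G N → γ ≤ N)

module Submission where

-- View P_m □ G as m stacked layers, each a copy of G, and let γ = γ(G). By induction on m:
-- if a distribution has at least γ(2^m − 1) + k·2^m pebbles, it can be pebbled so that every layer
-- but the first is covered and the first keeps γ + 2k pebbles. When the first layer already holds
-- γ + 2k, it sends pairs up to the second layer, exactly as many as the remaining layers lack for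
-- k = 0; otherwise the remaining layers are made to keep a reserve for the shortfall j, and j
-- pebbles come down from the second layer. Moving c pebbles across needs c pairs on common
-- vertices, which any γ + 2c pebbles on a layer contain because γ ≥ |V(G)|; and a layer holding at
-- least γ pebbles is covered within G, since cover solvability is monotone in the number of
-- pebbles. The case k = 0, m = n is the theorem.

open import Defs
open import Data.Nat using (ℕ; zero; suc; _+_; _*_; _∸_; _^_; _≤_; _<_; z≤n; s≤s; _≤?_; >-nonZero)
open import Data.Nat.Properties hiding (_≟_)
open import Data.Nat.ListAction using (sum)
open import Data.Nat.Tactic.RingSolver using (solve-∀)
open import Data.Nat.ListAction.Properties using (sum-++)
open import Algebra.Properties.CommutativeSemigroup +-commutativeSemigroup using (interchange; xy∙z≈xz∙y)
open import Data.List using (List; []; _∷_; _++_; map; length; tabulate; allFin; cartesianProduct)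
open import Data.Fin as Fin using (Fin; zero; suc)
open import Data.List.Properties using (map-++; map-∘; map-cong; map-tabulate)
open import Data.List.Membership.Propositional using (_∈_)
open import Data.List.Relation.Unary.Any using (here; there)
open import Data.List.Relation.Unary.All as All using (All; []; _∷_)
open import Data.List.Relation.Unary.AllPairs using ([]; _∷_)
open import Data.List.Relation.Unary.Unique.Propositional using (Unique)
open import Data.Product using (∃; ∃₂; _×_; _,_; map₁; map₂)
open import Data.Sum as Sum using (inj₁; inj₂)
open import Data.Empty using (⊥-elim)
open import Function using (const; id; _∘_)
open import Relation.Nullary using (Dec; yes; no)
open import Relation.Binary.Structures using (IsEquivalence; IsPreorder)
open import Relation.Binary.PropositionalEquality
open import Relation.Binary.Construct.Closure.ReflexiveTransitive using (ε; _◅_; _◅◅_; gmap)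
import Relation.Binary.Reasoning.Base.Double as DoubleReasoning

infixl 6 _⊕_
_⊕_ : {A : Set} → (A → ℕ) → (A → ℕ) → A → ℕ
(f ⊕ g) x = f x + g x

sum-map-⊕ : {A : Set} (f g : A → ℕ) (xs : List A) →
  sum (map (f ⊕ g) xs) ≡ sum (map f xs) + sum (map g xs)
sum-map-⊕ f g [] = refl
sum-map-⊕ f g (x ∷ xs) =
  trans (cong (f x + g x +_) (sum-map-⊕ f g xs)) (interchange (f x) (g x) _ _)

sum-map-cong : {A : Set} {f g : A → ℕ} → f ≗ g → (xs : List A) → sum (map f xs) ≡ sum (map g xs)
sum-map-cong f≗g xs = cong sum (map-cong f≗g xs)

sum-map-const0 : {A : Set} (xs : List A) → sum (map (const 0) xs) ≡ 0
sum-map-const0 [] = refl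
sum-map-const0 (x ∷ xs) = sum-map-const0 xs

sum-map≡0 : {A : Set} {f : A → ℕ} {xs : List A} → sum (map f xs) ≡ 0 → ∀ {x} → x ∈ xs → f x ≡ 0
sum-map≡0 {f = f} {y ∷ xs} s≡0 (here refl) = m+n≡0⇒m≡0 (f y) s≡0
sum-map≡0 {f = f} {y ∷ xs} s≡0 (there x∈xs) = sum-map≡0 (m+n≡0⇒n≡0 (f y) s≡0) x∈xs

sum-map-zero : {A : Set} {f : A → ℕ} {xs : List A} → All (λ x → f x ≡ 0) xs → sum (map f xs) ≡ 0
sum-map-zero [] = refl
sum-map-zero (fx≡0 ∷ rest) rewrite fx≡0 = sum-map-zero rest

sum-map-point : {A : Set} {f : A → ℕ} {xs : List A} {a : A} → Unique xs → a ∈ xs →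
  (∀ x → x ≢ a → f x ≡ 0) → sum (map f xs) ≡ f a
sum-map-point {f = f} (a∉xs ∷ _) (here refl) off =
  trans (cong (f _ +_) (sum-map-zero (All.map (λ a≢x → off _ (a≢x ∘ sym)) a∉xs))) (+-identityʳ _)
sum-map-point (x∉xs ∷ uniq) (there a∈xs) off
  rewrite off _ (All.lookup x∉xs a∈xs) = sum-map-point uniq a∈xs off

length≤sum-map : {A : Set} {f : A → ℕ} (xs : List A) → (∀ x → 1 ≤ f x) → length xs ≤ sum (map f xs)
length≤sum-map [] _ = z≤n
length≤sum-map (x ∷ xs) 1≤f = +-mono-≤ (1≤f x) (length≤sum-map xs 1≤f)

pigeonhole : {A : Set} (c : ℕ) (f : A → ℕ) (xs : List A) →
  length xs * c < sum (map f xs) → ∃ λ x → c < f x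
pigeonhole c f (x ∷ xs) bound with c <? f x
... | yes c<fx = x , c<fx
... | no c≮fx = pigeonhole c f xs (+-cancelˡ-< c _ _ (<-≤-trans bound (+-monoˡ-≤ _ (≮⇒≥ c≮fx))))

sum-map-cartesianProduct : {A B : Set} (f : A × B → ℕ) (xs : List A) (ys : List B) →
  sum (map f (cartesianProduct xs ys)) ≡ sum (map (λ x → sum (map (λ y → f (x , y)) ys)) xs)
sum-map-cartesianProduct f [] ys = refl
sum-map-cartesianProduct f (x ∷ xs) ys = begin
  sum (map f (map (x ,_) ys ++ cartesianProduct xs ys))
    ≡⟨ cong sum (map-++ f (map (x ,_) ys) _) ⟩
  sum (map f (map (x ,_) ys) ++ map f (cartesianProduct xs ys))
    ≡⟨ sum-++ (map f (map (x ,_) ys)) _ ⟩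
  sum (map f (map (x ,_) ys)) + sum (map f (cartesianProduct xs ys))
    ≡⟨ cong₂ _+_ (cong sum (sym (map-∘ ys))) (sum-map-cartesianProduct f xs ys) ⟩
  sum (map (λ y → f (x , y)) ys) + sum (map (λ x → sum (map (λ y → f (x , y)) ys)) xs) ∎
  where open ≡-Reasoning

unique-≟ : {A : Set} {xs : List A} → Unique xs → {x y : A} → x ∈ xs → y ∈ xs → Dec (x ≡ y)
unique-≟ (_ ∷ _) (here refl) (here refl) = yes refl
unique-≟ (x∉xs ∷ _) (here refl) (there y∈xs) = no (All.lookup x∉xs y∈xs)
unique-≟ (y∉xs ∷ _) (there x∈xs) (here refl) = no (All.lookup y∉xs x∈xs ∘ sym)
unique-≟ (_ ∷ uniq) (there x∈xs) (there y∈xs) = unique-≟ uniq x∈xs y∈xs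

≗-isEquivalence : {A : Set} → IsEquivalence (_≗_ {A = A} {B = ℕ})
≗-isEquivalence = record
  { refl = λ _ → refl ; sym = λ f≗g x → sym (f≗g x) ; trans = λ f≗g g≗h x → trans (f≗g x) (g≗h x) }

-- The target is reached only up to pointwise equality: without function extensionality this is
-- the form of reachability that is stable under rearranging sums of distributions.
infix 4 _⊢_⇝_
record _⊢_⇝_ (K : Graph) (d e : Distribution K) : Set where
  constructor reach
  field
    {end} : Distribution K
    steps : Reachable K d end
    end≗  : end ≗ e

⇝-map : {K L : Graph} (F : Distribution K → Distribution L) →
  (∀ {d d′} → PebblingStep K d d′ → PebblingStep L (F d) (F d′)) →
  (∀ {d e} → d ≗ e → F d ≗ F e) →
  ∀ {d e} → K ⊢ d ⇝ e → L ⊢ F d ⇝ F e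
⇝-map F F-step F-cong (reach ss q) = reach (gmap F F-step ss) (F-cong q)

module _ {K : Graph} where

  step-resp-≗ : {d d₁ d′ d₁′ : Distribution K} → d ≗ d₁ → d′ ≗ d₁′ →
    PebblingStep K d d′ → PebblingStep K d₁ d₁′
  step-resp-≗ d≗ d′≗ (u , v , u~v , du , dv , rest) =
    u , v , u~v ,
    trans (cong (_+ 2) (sym (d′≗ u))) (trans du (d≗ u)) ,
    trans (sym (d′≗ v)) (trans dv (cong (_+ 1) (d≗ v))) ,
    λ w w≢u w≢v → trans (sym (d′≗ w)) (trans (rest w w≢u w≢v) (d≗ w))

  step-⊕ʳ : {d d′ : Distribution K} (f : Distribution K) →
    PebblingStep K d d′ → PebblingStep K (d ⊕ f) (d′ ⊕ f)
  step-⊕ʳ {d} {d′} f (u , v , u~v , du , dv , rest) =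
    u , v , u~v ,
    trans (xy∙z≈xz∙y (d′ u) (f u) 2) (cong (_+ f u) du) ,
    trans (cong (_+ f v) dv) (xy∙z≈xz∙y (d v) 1 (f v)) ,
    λ w w≢u w≢v → cong (_+ f w) (rest w w≢u w≢v)

  ⇝-reflexive : {d e : Distribution K} → d ≗ e → K ⊢ d ⇝ e
  ⇝-reflexive d≗e = reach ε d≗e

  Reachable⇒⇝ : {d e : Distribution K} → Reachable K d e → K ⊢ d ⇝ e
  Reachable⇒⇝ ss = reach ss λ _ → refl

  ⇝-respˡ : {d d₁ e : Distribution K} → d ≗ d₁ → K ⊢ d₁ ⇝ e → K ⊢ d ⇝ e
  ⇝-respˡ d≗d₁ (reach ε q) = reach ε λ x → trans (d≗d₁ x) (q x)
  ⇝-respˡ d≗d₁ (reach (s ◅ ss) q) = reach (step-resp-≗ (λ x → sym (d≗d₁ x)) (λ _ → refl) s ◅ ss) q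

  ⇝-respʳ : {d e e₁ : Distribution K} → e ≗ e₁ → K ⊢ d ⇝ e → K ⊢ d ⇝ e₁
  ⇝-respʳ e≗e₁ (reach ss q) = reach ss λ x → trans (q x) (e≗e₁ x)

  ⇝-trans : {d e f : Distribution K} → K ⊢ d ⇝ e → K ⊢ e ⇝ f → K ⊢ d ⇝ f
  ⇝-trans (reach ss q) e⇝f with ⇝-respˡ q e⇝f
  ... | reach ts r = reach (ss ◅◅ ts) r

  ⇝-isPreorder : IsPreorder _≗_ (K ⊢_⇝_)
  ⇝-isPreorder = record { isEquivalence = ≗-isEquivalence ; reflexive = ⇝-reflexive ; trans = ⇝-trans }

  ⇝-cover : {d e : Distribution K} → K ⊢ d ⇝ e → IsCover K e → ∃ λ e′ → Reachable K d e′ × IsCover K e′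
  ⇝-cover (reach ss q) cover = _ , ss , λ v → subst (1 ≤_) (sym (q v)) (cover v)

  ⇝-⊕ʳ : {a a′ : Distribution K} (f : Distribution K) → K ⊢ a ⇝ a′ → K ⊢ a ⊕ f ⇝ a′ ⊕ f
  ⇝-⊕ʳ f = ⇝-map {K} {K} (_⊕ f) (step-⊕ʳ f) (λ p x → cong (_+ f x) (p x))

  ⇝-⊕ˡ : {b b′ : Distribution K} (f : Distribution K) → K ⊢ b ⇝ b′ → K ⊢ f ⊕ b ⇝ f ⊕ b′
  ⇝-⊕ˡ {b} {b′} f b⇝b′ =
    ⇝-respˡ (λ x → +-comm (f x) (b x)) (⇝-respʳ (λ x → +-comm (b′ x) (f x)) (⇝-⊕ʳ f b⇝b′))

  ⇝-⊕ : {a a′ b b′ : Distribution K} → K ⊢ a ⇝ a′ → K ⊢ b ⇝ b′ → K ⊢ a ⊕ b ⇝ a′ ⊕ b′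
  ⇝-⊕ {a′ = a′} {b} a⇝a′ b⇝b′ = ⇝-trans (⇝-⊕ʳ b a⇝a′) (⇝-⊕ˡ a′ b⇝b′)

module ⇝-Reasoning (K : Graph) = DoubleReasoning (⇝-isPreorder {K})

size-⊕ : (K : Graph) (f g : Distribution K) → size K (f ⊕ g) ≡ size K f + size K g
size-⊕ K f g = sum-map-⊕ f g (verts K)

size-cong : (K : Graph) {f g : Distribution K} → f ≗ g → size K f ≡ size K g
size-cong K f≗g = sum-map-cong f≗g (verts K)

size-≗-⊕ : (K : Graph) {d f g : Distribution K} → d ≗ f ⊕ g → size K d ≡ size K f + size K g
size-≗-⊕ K {f = f} {g} d≗f⊕g = trans (size-cong K d≗f⊕g) (size-⊕ K f g)

one-layer-bound : ∀ {γ k a} → (γ + k) * 2 ≤ a + 0 + γ → γ + 2 * k ≤ a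
one-layer-bound {γ} {k} {a} bound = +-cancelʳ-≤ γ _ _ (begin
  γ + 2 * k + γ  ≡⟨ regroup γ k ⟩
  (γ + k) * 2    ≤⟨ bound ⟩
  a + 0 + γ      ≡⟨ cong (_+ γ) (+-identityʳ a) ⟩
  a + γ          ∎)
  where
  open ≤-Reasoning
  regroup : ∀ γ k → γ + 2 * k + γ ≡ (γ + k) * 2
  regroup = solve-∀

surplus-bound : ∀ {γ k a b P} → 1 ≤ P → γ + 2 * k ≤ a → (γ + k) * (2 * P) ≤ a + b + γ →
  ∃ λ c → γ + 2 * k + 2 * c ≤ a × (γ + 0) * P ≤ b + c + γ
surplus-bound {γ} {k} {a} {b} {P} 1≤P γ+2k≤a bound with γ * P ≤? b + γ
... | yes γP≤b+γ =
  0 , subst (_≤ a) (sym (+-identityʳ _)) γ+2k≤a ,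
  subst₂ _≤_ (cong (_* P) (sym (+-identityʳ γ))) (cong (_+ γ) (sym (+-identityʳ b))) γP≤b+γ
... | no γP≰b+γ with m≤n⇒∃[o]m+o≡n (<⇒≤ (≰⇒> γP≰b+γ))
...   | c , b+γ+c≡γP = c , +-cancelʳ-≤ (b + γ + b) _ _ chain ,
  ≤-reflexive (trans (cong (_* P) (+-identityʳ γ)) (trans (sym b+γ+c≡γP) (xy∙z≈xz∙y b γ c)))
  where
  open ≤-Reasoning
  chain : γ + 2 * k + 2 * c + (b + γ + b) ≤ a + (b + γ + b)
  chain = begin
    γ + 2 * k + 2 * c + (b + γ + b)  ≡⟨ e₁ γ k c b ⟩
    2 * (b + γ + c) + 2 * k          ≡⟨ cong (λ x → 2 * x + 2 * k) b+γ+c≡γP ⟩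
    2 * (γ * P) + 2 * k              ≤⟨ +-monoʳ-≤ (2 * (γ * P)) (*-monoʳ-≤ 2 (m≤m*n k P {{>-nonZero 1≤P}})) ⟩
    2 * (γ * P) + 2 * (k * P)        ≡⟨ e₂ γ k P ⟩
    (γ + k) * (2 * P)                ≤⟨ bound ⟩
    a + b + γ                        ≤⟨ m≤m+n (a + b + γ) b ⟩
    a + b + γ + b                    ≡⟨ e₃ a b γ ⟩
    a + (b + γ + b)                  ∎
    where
    e₁ : ∀ γ k c b → γ + 2 * k + 2 * c + (b + γ + b) ≡ 2 * (b + γ + c) + 2 * k
    e₁ = solve-∀
    e₂ : ∀ γ k P → 2 * (γ * P) + 2 * (k * P) ≡ (γ + k) * (2 * P)
    e₂ = solve-∀
    e₃ : ∀ a b γ → a + b + γ + b ≡ a + (b + γ + b)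
    e₃ = solve-∀

deficit-bound : ∀ {γ k a b j P} → 1 ≤ P → a + j ≡ γ + 2 * k → (γ + k) * (2 * P) ≤ a + b + γ →
  (γ + j) * P ≤ b + γ
deficit-bound {γ} {k} {a} {b} {j} {P} 1≤P a+j≡γ+2k bound = +-cancelʳ-≤ a _ _ (begin
  (γ + j) * P + a            ≤⟨ +-monoʳ-≤ ((γ + j) * P) (m≤m*n a P {{>-nonZero 1≤P}}) ⟩
  (γ + j) * P + a * P        ≡⟨ e₁ γ j a P ⟩
  (γ + (a + j)) * P          ≡⟨ cong (λ x → (γ + x) * P) a+j≡γ+2k ⟩
  (γ + (γ + 2 * k)) * P      ≡⟨ e₂ γ k P ⟩
  (γ + k) * (2 * P)          ≤⟨ bound ⟩
  a + b + γ                  ≡⟨ e₃ a b γ ⟩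
  b + γ + a                  ∎)
  where
  open ≤-Reasoning
  e₁ : ∀ γ j a P → (γ + j) * P + a * P ≡ (γ + (a + j)) * P
  e₁ = solve-∀
  e₂ : ∀ γ k P → (γ + (γ + 2 * k)) * P ≡ (γ + k) * (2 * P)
  e₂ = solve-∀
  e₃ : ∀ a b γ → a + b + γ ≡ b + γ + a
  e₃ = solve-∀

initial-bound : ∀ γ n → (γ + 0) * 2 ^ n ≤ γ * (2 ^ n ∸ 1) + γ
initial-bound γ n = ≤-reflexive (begin-equality
  (γ + 0) * 2 ^ n            ≡⟨ cong (_* 2 ^ n) (+-identityʳ γ) ⟩
  γ * 2 ^ n                  ≡⟨ cong (γ *_) (sym (m∸n+n≡m (m^n>0 2 n))) ⟩
  γ * (2 ^ n ∸ 1 + 1)        ≡⟨ *-distribˡ-+ γ (2 ^ n ∸ 1) 1 ⟩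
  γ * (2 ^ n ∸ 1) + γ * 1    ≡⟨ cong (γ * (2 ^ n ∸ 1) +_) (*-identityʳ γ) ⟩
  γ * (2 ^ n ∸ 1) + γ        ∎)
  where open ≤-Reasoning

module FiniteGraph (G : Graph) (fsc : IsFiniteSimpleConnected G) where
  open IsFiniteSimpleConnected fsc

  ‖_‖ : Distribution G → ℕ
  ‖ β ‖ = size G β

  _≟_ : (u v : V G) → Dec (u ≡ v)
  u ≟ v = unique-≟ unique (complete u) (complete v)

  pt : V G → ℕ → Distribution G
  pt g c w with w ≟ g
  ... | yes _ = c
  ... | no _ = 0

  pt-self : (g : V G) (c : ℕ) → pt g c g ≡ c
  pt-self g c with g ≟ g
  ... | yes _ = refl
  ... | no g≢g = ⊥-elim (g≢g refl)

  pt-other : {g w : V G} (c : ℕ) → w ≢ g → pt g c w ≡ 0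
  pt-other {g} {w} c w≢g with w ≟ g
  ... | yes w≡g = ⊥-elim (w≢g w≡g)
  ... | no _ = refl

  pt-+ : (g : V G) (a b : ℕ) → pt g (a + b) ≗ pt g a ⊕ pt g b
  pt-+ g a b w with w ≟ g
  ... | yes _ = refl
  ... | no _ = refl

  size-pt : (g : V G) (c : ℕ) → ‖ pt g c ‖ ≡ c
  size-pt g c = trans (sum-map-point unique (complete g) (λ _ → pt-other c)) (pt-self g c)

  ‖‖≡0⇒≗0 : {β : Distribution G} → ‖ β ‖ ≡ 0 → β ≗ const 0
  ‖‖≡0⇒≗0 ‖β‖≡0 g = sum-map≡0 ‖β‖≡0 (complete g)

  split-off : {β : Distribution G} {g : V G} {c : ℕ} → c ≤ β g → ∃ λ β′ → β ≗ β′ ⊕ pt g c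
  split-off {β} {g} {c} c≤βg = (λ w → β w ∸ pt g c w) , λ w → sym (m∸n+n≡m (pt≤β w))
    where
    pt≤β : ∀ w → pt g c w ≤ β w
    pt≤β w with w ≟ g
    ... | yes refl = c≤βg
    ... | no _ = z≤n

  size-≗-⊕-pt : {β β′ : Distribution G} {g : V G} {c : ℕ} → β ≗ β′ ⊕ pt g c → ‖ β ‖ ≡ ‖ β′ ‖ + c
  size-≗-⊕-pt {β′ = β′} {g} {c} β≗ = trans (size-≗-⊕ G β≗) (cong (‖ β′ ‖ +_) (size-pt g c))

  peel : {β : Distribution G} {t : ℕ} → ‖ β ‖ ≡ suc t →
    ∃₂ λ g β′ → β ≗ β′ ⊕ pt g 1 × ‖ β′ ‖ ≡ t
  peel {β} {t} ‖β‖≡1+t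
    with pigeonhole 0 β (verts G) (subst₂ _<_ (sym (*-zeroʳ (length (verts G)))) (sym ‖β‖≡1+t) (s≤s z≤n))
  ... | g , 0<βg with split-off 0<βg
  ... | β′ , β≗ = g , β′ , β≗ ,
    +-cancelʳ-≡ 1 _ _ (trans (sym (size-≗-⊕-pt β≗)) (trans ‖β‖≡1+t (+-comm 1 t)))

  extract-pairs : (c : ℕ) {β : Distribution G} → length (verts G) + 2 * c ≤ ‖ β ‖ →
    ∃₂ λ β′ μ → β ≗ β′ ⊕ (μ ⊕ μ) × ‖ μ ‖ ≡ c
  extract-pairs zero {β} _ = β , const 0 , (λ w → sym (+-identityʳ (β w))) , sum-map-const0 (verts G)
  extract-pairs (suc c) {β} bound
    with pigeonhole 1 β (verts G)
           (subst (_< ‖ β ‖) (sym (*-identityʳ _)) (<-≤-trans (m<m+n _ (s≤s z≤n)) bound))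
  ... | g , 2≤βg with split-off 2≤βg
  ... | β₁ , β≗β₁⊕2g with extract-pairs c {β₁} (+-cancelʳ-≤ 2 _ _ bound′)
    where
    bound′ : length (verts G) + 2 * c + 2 ≤ ‖ β₁ ‖ + 2
    bound′ = subst₂ _≤_ (shuffle (length (verts G)) c) (size-≗-⊕-pt β≗β₁⊕2g) bound
      where
      shuffle : ∀ l c → l + 2 * suc c ≡ l + 2 * c + 2
      shuffle = solve-∀
  ... | β′ , μ , β₁≗β′⊕2μ , ‖μ‖≡c =
    β′ , μ ⊕ pt g 1 , β≗ ,
    trans (size-⊕ G μ (pt g 1)) (trans (cong₂ _+_ ‖μ‖≡c (size-pt g 1)) (+-comm c 1))
    where
    regroup : ∀ b m p → b + (m + m) + (p + p) ≡ b + ((m + p) + (m + p))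
    regroup = solve-∀
    β≗ : β ≗ β′ ⊕ ((μ ⊕ pt g 1) ⊕ (μ ⊕ pt g 1))
    β≗ w = begin
      β w                                            ≡⟨ β≗β₁⊕2g w ⟩
      β₁ w + pt g 2 w                                ≡⟨ cong₂ _+_ (β₁≗β′⊕2μ w) (pt-+ g 1 1 w) ⟩
      β′ w + (μ w + μ w) + (pt g 1 w + pt g 1 w)     ≡⟨ regroup (β′ w) (μ w) (pt g 1 w) ⟩
      β′ w + ((μ w + pt g 1 w) + (μ w + pt g 1 w))   ∎
      where open ≡-Reasoning

  size-pairs : {β β′ μ : Distribution G} {c : ℕ} →
    β ≗ β′ ⊕ (μ ⊕ μ) → ‖ μ ‖ ≡ c → ‖ β ‖ ≡ ‖ β′ ‖ + 2 * c
  size-pairs {β} {β′} {μ} {c} β≗ ‖μ‖≡c = begin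
    ‖ β ‖                   ≡⟨ size-≗-⊕ G β≗ ⟩
    ‖ β′ ‖ + ‖ μ ⊕ μ ‖      ≡⟨ cong (‖ β′ ‖ +_) (size-⊕ G μ μ) ⟩
    ‖ β′ ‖ + (‖ μ ‖ + ‖ μ ‖) ≡⟨ cong (λ s → ‖ β′ ‖ + (s + s)) ‖μ‖≡c ⟩
    ‖ β′ ‖ + (c + c)         ≡⟨ cong (λ s → ‖ β′ ‖ + (c + s)) (sym (+-identityʳ c)) ⟩
    ‖ β′ ‖ + 2 * c           ∎
    where open ≡-Reasoning

  step-loses-one : {d d′ : Distribution G} → PebblingStep G d d′ → suc ‖ d′ ‖ ≡ ‖ d ‖
  step-loses-one {d} {d′} (u , v , u~v , du , dv , rest) = +-cancelʳ-≡ 1 _ _ (begin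
    suc ‖ d′ ‖ + 1    ≡⟨ sym (+-suc ‖ d′ ‖ 1) ⟩
    ‖ d′ ‖ + 2        ≡⟨ sym (size-≗-⊕-pt balance) ⟩
    ‖ d ⊕ pt v 1 ‖    ≡⟨ size-≗-⊕-pt (λ _ → refl) ⟩
    ‖ d ‖ + 1         ∎)
    where
    open ≡-Reasoning
    balance : d ⊕ pt v 1 ≗ d′ ⊕ pt u 2
    balance w with w ≟ u | w ≟ v
    ... | yes refl | yes refl = ⊥-elim (irreflexive u~v)
    ... | yes refl | no _     = trans (+-identityʳ _) (sym du)
    ... | no _     | yes refl = trans (sym dv) (sym (+-identityʳ _))
    ... | no w≢u   | no w≢v   = cong (_+ 0) (sym (rest w w≢u w≢v))

  ⇝-size : {d e : Distribution G} → G ⊢ d ⇝ e → ‖ e ‖ ≤ ‖ d ‖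
  ⇝-size (reach ss e′≗e) = subst (_≤ _) (size-cong G e′≗e) (star-size ss)
    where
    star-size : ∀ {d e} → Reachable G d e → ‖ e ‖ ≤ ‖ d ‖
    star-size ε = ≤-refl
    star-size (s ◅ ss) = ≤-trans (star-size ss) (subst (_ ≤_) (step-loses-one s) (n≤1+n _))

  coverSolvable-suc : {N : ℕ} → CoverSolvable G N → CoverSolvable G (suc N)
  coverSolvable-suc solvable d ‖d‖≡1+N with peel ‖d‖≡1+N
  ... | g , d′ , d≗d′⊕g , ‖d′‖≡N with solvable d′ ‖d′‖≡N
  ... | e , ss , cover =
    ⇝-cover {G} (⇝-respˡ d≗d′⊕g (⇝-⊕ʳ (pt g 1) (Reachable⇒⇝ ss)))
      λ w → ≤-trans (cover w) (m≤m+n _ _)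

  coverSolvable-mono : {N M : ℕ} → CoverSolvable G N → N ≤ M → CoverSolvable G M
  coverSolvable-mono solvable N≤M with m≤n⇒∃[o]m+o≡n N≤M
  ... | o , refl = go o
    where
    go : ∀ o → CoverSolvable G (_ + o)
    go zero = subst (CoverSolvable G) (sym (+-identityʳ _)) solvable
    go (suc o) = subst (CoverSolvable G) (sym (+-suc _ o)) (coverSolvable-suc (go o))

  length-verts≤ : {N : ℕ} → CoverSolvable G N → length (verts G) ≤ N
  length-verts≤ {N} solvable = bound (verts G) refl
    where
    bound : (vs : List (V G)) → vs ≡ verts G → length vs ≤ N
    bound [] _ = z≤n
    bound (v ∷ _) vs≡ with solvable (pt v N) (size-pt v N)
    ... | e , ss , cover = subst (λ vs → length vs ≤ N) (sym vs≡) (begin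
      length (verts G)  ≤⟨ length≤sum-map (verts G) cover ⟩
      ‖ e ‖             ≤⟨ ⇝-size (Reachable⇒⇝ ss) ⟩
      ‖ pt v N ‖        ≡⟨ size-pt v N ⟩
      N                 ∎)
      where open ≤-Reasoning

  Layers : ℕ → Graph
  Layers n = Path n □ G

  infixr 5 _◂_
  _◂_ : {n : ℕ} → Distribution G → Distribution (Layers n) → Distribution (Layers (suc n))
  (α ◂ r) (zero , g) = α g
  (α ◂ r) (suc i , g) = r (i , g)

  head : {n : ℕ} → Distribution (Layers (suc n)) → Distribution G
  head d g = d (zero , g)

  tail : {n : ℕ} → Distribution (Layers (suc n)) → Distribution (Layers n)
  tail d (i , g) = d (suc i , g)

  head◂tail : {n : ℕ} (d : Distribution (Layers (suc n))) → d ≗ head d ◂ tail d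
  head◂tail d (zero , g) = refl
  head◂tail d (suc i , g) = refl

  ◂-cong : {n : ℕ} {α α′ : Distribution G} {r r′ : Distribution (Layers n)} →
    α ≗ α′ → r ≗ r′ → α ◂ r ≗ α′ ◂ r′
  ◂-cong α≗α′ r≗r′ (zero , g) = α≗α′ g
  ◂-cong α≗α′ r≗r′ (suc i , g) = r≗r′ (i , g)

  size-◂ : {n : ℕ} (α : Distribution G) (r : Distribution (Layers n)) →
    size (Layers (suc n)) (α ◂ r) ≡ ‖ α ‖ + size (Layers n) r
  size-◂ {n} α r = begin
    size (Layers (suc n)) (α ◂ r)
      ≡⟨ sum-map-cartesianProduct (α ◂ r) (allFin (suc n)) (verts G) ⟩
    ‖ α ‖ + sum (map row (tabulate suc))
      ≡⟨ cong (λ rows → ‖ α ‖ + sum rows) (map-tabulate suc row) ⟩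
    ‖ α ‖ + sum (tabulate (row ∘ suc))
      ≡⟨ cong (λ rows → ‖ α ‖ + sum rows) (sym (map-tabulate id (row ∘ suc))) ⟩
    ‖ α ‖ + sum (map (row ∘ suc) (allFin n))
      ≡⟨ cong (‖ α ‖ +_) (sym (sum-map-cartesianProduct r (allFin n) (verts G))) ⟩
    ‖ α ‖ + size (Layers n) r ∎
    where
    open ≡-Reasoning
    row : Fin (suc n) → ℕ
    row i = sum (map (λ g → (α ◂ r) (i , g)) (verts G))

  ◂-cover : {n : ℕ} {α : Distribution G} {r : Distribution (Layers n)} →
    IsCover G α → IsCover (Layers n) r → IsCover (Layers (suc n)) (α ◂ r)
  ◂-cover α-cover r-cover (zero , g) = α-cover g
  ◂-cover α-cover r-cover (suc i , g) = r-cover (i , g)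

  step-◂ˡ : {n : ℕ} {α α′ : Distribution G} {r : Distribution (Layers n)} →
    PebblingStep G α α′ → PebblingStep (Layers (suc n)) (α ◂ r) (α′ ◂ r)
  step-◂ˡ (u , v , u~v , du , dv , rest) =
    (zero , u) , (zero , v) , inj₁ (refl , u~v) , du , dv , λ where
      (zero , g) ≢u ≢v → rest g (≢u ∘ cong (zero ,_)) (≢v ∘ cong (zero ,_))
      (suc i , g) _ _ → refl

  step-◂ʳ : {n : ℕ} {α : Distribution G} {r r′ : Distribution (Layers n)} →
    PebblingStep (Layers n) r r′ → PebblingStep (Layers (suc n)) (α ◂ r) (α ◂ r′)
  step-◂ʳ ((i , u) , (j , v) , adj , du , dv , rest) =
    (suc i , u) , (suc j , v) , shift adj , du , dv , λ where
      (zero , g) _ _ → refl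
      (suc l , g) ≢u ≢v → rest (l , g) (≢u ∘ cong (map₁ suc)) (≢v ∘ cong (map₁ suc))
    where
    shift = Sum.map (map₁ (cong suc)) (map₂ (Sum.map (cong suc) (cong suc)))

  ⇝-◂ˡ : {n : ℕ} {α α′ : Distribution G} {r : Distribution (Layers n)} →
    G ⊢ α ⇝ α′ → Layers (suc n) ⊢ α ◂ r ⇝ α′ ◂ r
  ⇝-◂ˡ = ⇝-map (_◂ _) step-◂ˡ (λ α≗α′ → ◂-cong α≗α′ (λ _ → refl))

  ⇝-◂ʳ : {n : ℕ} {α : Distribution G} {r r′ : Distribution (Layers n)} →
    Layers n ⊢ r ⇝ r′ → Layers (suc n) ⊢ α ◂ r ⇝ α ◂ r′
  ⇝-◂ʳ = ⇝-map (_ ◂_) step-◂ʳ (◂-cong (λ _ → refl))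

  onLayer : {n : ℕ} → Fin n → Distribution G → Distribution (Layers n)
  onLayer zero β = β ◂ const 0
  onLayer (suc i) β = const 0 ◂ onLayer i β

  onLayer-self : {n : ℕ} (i : Fin n) (β : Distribution G) (g : V G) → onLayer i β (i , g) ≡ β g
  onLayer-self zero β g = refl
  onLayer-self (suc i) β g = onLayer-self i β g

  onLayer-other : {n : ℕ} {i l : Fin n} (β : Distribution G) (g : V G) → l ≢ i → onLayer i β (l , g) ≡ 0
  onLayer-other {i = zero} {zero} _ _ l≢i = ⊥-elim (l≢i refl)
  onLayer-other {i = zero} {suc l} _ _ _ = refl
  onLayer-other {i = suc i} {zero} _ _ _ = refl
  onLayer-other {i = suc i} {suc l} β g l≢i = onLayer-other β g (l≢i ∘ cong suc)

  onLayer-pt-other : {n : ℕ} {i l : Fin n} {g h : V G} (c : ℕ) →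
    (l , h) ≢ (i , g) → onLayer i (pt g c) (l , h) ≡ 0
  onLayer-pt-other {i = i} {l} {g} {h} c ≢ig with l Fin.≟ i
  ... | yes refl = trans (onLayer-self i (pt g c) h) (pt-other c (≢ig ∘ cong (i ,_)))
  ... | no l≢i = onLayer-other (pt g c) h l≢i

  onLayer-⊕ : {n : ℕ} (i : Fin n) (a b : Distribution G) → onLayer i (a ⊕ b) ≗ onLayer i a ⊕ onLayer i b
  onLayer-⊕ zero a b (zero , g) = refl
  onLayer-⊕ zero a b (suc l , g) = refl
  onLayer-⊕ (suc i) a b (zero , g) = refl
  onLayer-⊕ (suc i) a b (suc l , g) = onLayer-⊕ i a b (l , g)

  onLayer-cong : {n : ℕ} (i : Fin n) {a b : Distribution G} → a ≗ b → onLayer i a ≗ onLayer i b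
  onLayer-cong zero a≗b = ◂-cong a≗b (λ _ → refl)
  onLayer-cong (suc i) a≗b = ◂-cong (λ _ → refl) (onLayer-cong i a≗b)

  onLayer-const0 : {n : ℕ} (i : Fin n) → onLayer i (const 0) ≗ const 0
  onLayer-const0 zero (zero , g) = refl
  onLayer-const0 zero (suc l , g) = refl
  onLayer-const0 (suc i) (zero , g) = refl
  onLayer-const0 (suc i) (suc l , g) = onLayer-const0 i (l , g)

  adjacent⇒≢ : {n : ℕ} {i j : Fin n} → _~_ (Path n) i j → i ≢ j
  adjacent⇒≢ (inj₁ j≡1+i) refl = 1+n≢n (sym j≡1+i)
  adjacent⇒≢ (inj₂ i≡1+j) refl = 1+n≢n (sym i≡1+j)

  onLayer-step : {n : ℕ} {i j : Fin n} (g : V G) → _~_ (Path n) i j →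
    PebblingStep (Layers n) (onLayer i (pt g 2)) (onLayer j (pt g 1))
  onLayer-step {i = i} {j} g i~j =
    (i , g) , (j , g) , inj₂ (refl , i~j) , source , target ,
    λ w ≢ig ≢jg → trans (onLayer-pt-other 1 ≢jg) (sym (onLayer-pt-other 2 ≢ig))
    where
    open ≡-Reasoning
    i≢j = adjacent⇒≢ i~j
    source : onLayer j (pt g 1) (i , g) + 2 ≡ onLayer i (pt g 2) (i , g)
    source = begin
      onLayer j (pt g 1) (i , g) + 2  ≡⟨ cong (_+ 2) (onLayer-other (pt g 1) g i≢j) ⟩
      2                               ≡⟨ sym (pt-self g 2) ⟩
      pt g 2 g                        ≡⟨ sym (onLayer-self i (pt g 2) g) ⟩
      onLayer i (pt g 2) (i , g)      ∎
    target : onLayer j (pt g 1) (j , g) ≡ onLayer i (pt g 2) (j , g) + 1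
    target = begin
      onLayer j (pt g 1) (j , g)      ≡⟨ onLayer-self j (pt g 1) g ⟩
      pt g 1 g                        ≡⟨ pt-self g 1 ⟩
      1                               ≡⟨ cong (_+ 1) (sym (onLayer-other (pt g 2) g (i≢j ∘ sym))) ⟩
      onLayer i (pt g 2) (j , g) + 1  ∎

  onLayer-pairs : {n : ℕ} {i j : Fin n} → _~_ (Path n) i j →
    (μ : Distribution G) → Layers n ⊢ onLayer i (μ ⊕ μ) ⇝ onLayer j μ
  onLayer-pairs {n} {i} {j} i~j μ = go ‖ μ ‖ μ refl
    where
    open ⇝-Reasoning (Layers n)
    go : ∀ t μ → ‖ μ ‖ ≡ t → Layers n ⊢ onLayer i (μ ⊕ μ) ⇝ onLayer j μ
    go zero μ ‖μ‖≡0 = begin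
      onLayer i (μ ⊕ μ)     ≈⟨ onLayer-cong i (λ g → cong₂ _+_ (μ≗0 g) (μ≗0 g)) ⟩
      onLayer i (const 0)   ≈⟨ onLayer-const0 i ⟩
      const 0               ≈⟨ onLayer-const0 j ⟨
      onLayer j (const 0)   ≈⟨ onLayer-cong j μ≗0 ⟨
      onLayer j μ           ∎
      where
      μ≗0 = ‖‖≡0⇒≗0 ‖μ‖≡0
    go (suc t) μ ‖μ‖≡1+t with peel ‖μ‖≡1+t
    ... | g , μ′ , μ≗μ′⊕g , ‖μ′‖≡t = begin
      onLayer i (μ ⊕ μ)                          ≈⟨ onLayer-cong i regroup ⟩
      onLayer i ((μ′ ⊕ μ′) ⊕ pt g 2)             ≈⟨ onLayer-⊕ i (μ′ ⊕ μ′) (pt g 2) ⟩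
      onLayer i (μ′ ⊕ μ′) ⊕ onLayer i (pt g 2)   ≲⟨ ⇝-⊕ (go t μ′ ‖μ′‖≡t) one-step ⟩
      onLayer j μ′ ⊕ onLayer j (pt g 1)          ≈⟨ onLayer-⊕ j μ′ (pt g 1) ⟨
      onLayer j (μ′ ⊕ pt g 1)                    ≈⟨ onLayer-cong j μ≗μ′⊕g ⟨
      onLayer j μ                                ∎
      where
      one-step : Layers n ⊢ onLayer i (pt g 2) ⇝ onLayer j (pt g 1)
      one-step = Reachable⇒⇝ (onLayer-step g i~j ◅ ε)
      regroup : μ ⊕ μ ≗ (μ′ ⊕ μ′) ⊕ pt g 2
      regroup w = trans (cong₂ _+_ (μ≗μ′⊕g w) (μ≗μ′⊕g w))
        (trans (interchange (μ′ w) (pt g 1 w) (μ′ w) (pt g 1 w))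
               (cong (μ′ w + μ′ w +_) (sym (pt-+ g 1 1 w))))

  size-onLayer : {n : ℕ} (i : Fin n) (β : Distribution G) → size (Layers n) (onLayer i β) ≡ ‖ β ‖
  size-onLayer {suc n} zero β = begin
    size (Layers (suc n)) (β ◂ const 0) ≡⟨ size-◂ β (const 0) ⟩
    ‖ β ‖ + size (Layers n) (const 0)  ≡⟨ cong (‖ β ‖ +_) (sum-map-const0 (verts (Layers n))) ⟩
    ‖ β ‖ + 0                          ≡⟨ +-identityʳ _ ⟩
    ‖ β ‖                              ∎
    where open ≡-Reasoning
  size-onLayer {suc n} (suc i) β = begin
    size (Layers (suc n)) (const 0 ◂ onLayer i β) ≡⟨ size-◂ (const 0) (onLayer i β) ⟩
    ‖ const 0 ‖ + size (Layers n) (onLayer i β)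
      ≡⟨ cong (_+ size (Layers n) (onLayer i β)) (sum-map-const0 (verts G)) ⟩
    size (Layers n) (onLayer i β)                ≡⟨ size-onLayer i β ⟩
    ‖ β ‖                                        ∎
    where open ≡-Reasoning

  module _ {γ : ℕ} (solvable : CoverSolvable G γ) where

    take-pairs : (c : ℕ) {ℓ : ℕ} {β : Distribution G} → γ ≤ ℓ → ℓ + 2 * c ≤ ‖ β ‖ →
      ∃₂ λ β′ μ → β ≗ β′ ⊕ (μ ⊕ μ) × ‖ μ ‖ ≡ c × ℓ ≤ ‖ β′ ‖
    take-pairs c γ≤ℓ ℓ+2c≤‖β‖
      with extract-pairs c (≤-trans (+-monoˡ-≤ (2 * c) (≤-trans (length-verts≤ solvable) γ≤ℓ)) ℓ+2c≤‖β‖)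
    ... | β′ , μ , β≗β′⊕2μ , ‖μ‖≡c =
      β′ , μ , β≗β′⊕2μ , ‖μ‖≡c ,
      +-cancelʳ-≤ (2 * c) _ _ (≤-trans ℓ+2c≤‖β‖ (≤-reflexive (size-pairs β≗β′⊕2μ ‖μ‖≡c)))

    cover-layer : {n : ℕ} {α : Distribution G} {r : Distribution (Layers n)} →
      γ ≤ ‖ α ‖ → IsCover (Layers n) r →
      ∃ λ α′ → Layers (suc n) ⊢ α ◂ r ⇝ α′ ◂ r × IsCover (Layers (suc n)) (α′ ◂ r)
    cover-layer {α = α} γ≤‖α‖ r-cover with coverSolvable-mono solvable γ≤‖α‖ α refl
    ... | α′ , ss , α′-cover = α′ , ⇝-◂ˡ (Reachable⇒⇝ ss) , ◂-cover α′-cover r-cover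

    -- The first layer keeps γ pebbles to cover itself and k pairs to send to a neighbour.
    CoverWithReserve : (n k : ℕ) → Distribution (Layers (suc n)) → Set
    CoverWithReserve n k d =
      ∃₂ λ α r → Layers (suc n) ⊢ d ⇝ α ◂ r × γ + 2 * k ≤ ‖ α ‖ × IsCover (Layers n) r

    coverWithReserve-resp : {n k : ℕ} {d d′ : Distribution (Layers (suc n))} →
      d ≗ d′ → CoverWithReserve n k d′ → CoverWithReserve n k d
    coverWithReserve-resp d≗d′ (α , r , d′⇝α◂r , reserve , r-cover) =
      α , r , ⇝-respˡ d≗d′ d′⇝α◂r , reserve , r-cover

    -- γ(2^(n+1) − 1) + k·2^(n+1) ≤ size d, written without truncated subtraction.
    ReserveBound : (n k : ℕ) → Distribution (Layers (suc n)) → Set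
    ReserveBound n k d = (γ + k) * 2 ^ suc n ≤ size (Layers (suc n)) d + γ

    surplus-step : {n k : ℕ} → (∀ d → ReserveBound n 0 d → CoverWithReserve n 0 d) →
      {α : Distribution G} {d : Distribution (Layers (suc n))} → γ + 2 * k ≤ ‖ α ‖ →
      (γ + k) * 2 ^ suc (suc n) ≤ ‖ α ‖ + size (Layers (suc n)) d + γ →
      CoverWithReserve (suc n) k (α ◂ d)
    surplus-step {n} {k} cover-above {α} {d} enough bound
      with surplus-bound (m^n>0 2 (suc n)) enough bound
    ... | c , keep , bound′ with take-pairs c (m≤m+n γ (2 * k)) keep
    ... | α′ , μ , α≗α′⊕2μ , ‖μ‖≡c , γ+2k≤‖α′‖
      with cover-above (d ⊕ onLayer zero μ) (≤-trans bound′ (≤-reflexive (cong (_+ γ) (sym size-d⊕μ))))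
      where
      size-d⊕μ : size (Layers (suc n)) (d ⊕ onLayer zero μ) ≡ size (Layers (suc n)) d + c
      size-d⊕μ = trans (size-⊕ (Layers (suc n)) d (onLayer zero μ))
                       (cong (_ +_) (trans (size-onLayer zero μ) ‖μ‖≡c))
    ... | α₁ , r₁ , d⊕μ⇝α₁◂r₁ , γ≤‖α₁‖ , r₁-cover
      with cover-layer (≤-trans (m≤m+n γ 0) γ≤‖α₁‖) r₁-cover
    ... | α₂ , α₁◂r₁⇝α₂◂r₁ , α₂◂r₁-cover =
      α′ , α₂ ◂ r₁ , moves , γ+2k≤‖α′‖ , α₂◂r₁-cover
      where
      open ⇝-Reasoning (Layers (suc (suc n)))
      split : α ◂ d ≗ (α′ ◂ d) ⊕ onLayer zero (μ ⊕ μ)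
      split (zero , g) = α≗α′⊕2μ g
      split (suc i , g) = sym (+-identityʳ _)
      merge : (α′ ◂ d) ⊕ onLayer (suc zero) μ ≗ α′ ◂ (d ⊕ onLayer zero μ)
      merge (zero , g) = +-identityʳ _
      merge (suc i , g) = refl
      moves : Layers (suc (suc n)) ⊢ α ◂ d ⇝ α′ ◂ (α₂ ◂ r₁)
      moves = begin
        α ◂ d                              ≈⟨ split ⟩
        (α′ ◂ d) ⊕ onLayer zero (μ ⊕ μ)
          ≲⟨ ⇝-⊕ˡ (α′ ◂ d) (onLayer-pairs {i = zero} {suc zero} (inj₁ refl) μ) ⟩
        (α′ ◂ d) ⊕ onLayer (suc zero) μ    ≈⟨ merge ⟩
        α′ ◂ (d ⊕ onLayer zero μ)          ≲⟨ ⇝-◂ʳ d⊕μ⇝α₁◂r₁ ⟩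
        α′ ◂ (α₁ ◂ r₁)                     ≲⟨ ⇝-◂ʳ α₁◂r₁⇝α₂◂r₁ ⟩
        α′ ◂ (α₂ ◂ r₁)                     ∎

    deficit-step : {n k : ℕ} → (∀ j d → ReserveBound n j d → CoverWithReserve n j d) →
      {α : Distribution G} {d : Distribution (Layers (suc n))} → ‖ α ‖ < γ + 2 * k →
      (γ + k) * 2 ^ suc (suc n) ≤ ‖ α ‖ + size (Layers (suc n)) d + γ →
      CoverWithReserve (suc n) k (α ◂ d)
    deficit-step {n} {k} cover-above {α} {d} short bound with m≤n⇒∃[o]m+o≡n (<⇒≤ short)
    ... | j , ‖α‖+j≡γ+2k
      with cover-above j d (deficit-bound {γ} {k} {‖ α ‖} (m^n>0 2 (suc n)) ‖α‖+j≡γ+2k bound)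
    ... | α₁ , r₁ , d⇝α₁◂r₁ , γ+2j≤‖α₁‖ , r₁-cover with take-pairs j ≤-refl γ+2j≤‖α₁‖
    ... | α₁′ , μ , α₁≗α₁′⊕2μ , ‖μ‖≡j , γ≤‖α₁′‖ with cover-layer γ≤‖α₁′‖ r₁-cover
    ... | α₂ , α₁′◂r₁⇝α₂◂r₁ , α₂◂r₁-cover =
      α ⊕ μ , α₂ ◂ r₁ , moves , ≤-reflexive size-α⊕μ , α₂◂r₁-cover
      where
      open ⇝-Reasoning (Layers (suc (suc n)))
      size-α⊕μ : γ + 2 * k ≡ ‖ α ⊕ μ ‖
      size-α⊕μ = trans (sym ‖α‖+j≡γ+2k) (trans (cong (‖ α ‖ +_) (sym ‖μ‖≡j)) (sym (size-⊕ G α μ)))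
      split : α ◂ (α₁ ◂ r₁) ≗ (α ◂ (α₁′ ◂ r₁)) ⊕ onLayer (suc zero) (μ ⊕ μ)
      split (zero , g) = sym (+-identityʳ (α g))
      split (suc zero , g) = α₁≗α₁′⊕2μ g
      split (suc (suc i) , g) = sym (+-identityʳ _)
      merge : (α ◂ (α₁′ ◂ r₁)) ⊕ onLayer zero μ ≗ (α ⊕ μ) ◂ (α₁′ ◂ r₁)
      merge (zero , g) = refl
      merge (suc i , g) = +-identityʳ _
      moves : Layers (suc (suc n)) ⊢ α ◂ d ⇝ (α ⊕ μ) ◂ (α₂ ◂ r₁)
      moves = begin
        α ◂ d                                           ≲⟨ ⇝-◂ʳ d⇝α₁◂r₁ ⟩
        α ◂ (α₁ ◂ r₁)                                   ≈⟨ split ⟩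
        (α ◂ (α₁′ ◂ r₁)) ⊕ onLayer (suc zero) (μ ⊕ μ)
          ≲⟨ ⇝-⊕ˡ (α ◂ (α₁′ ◂ r₁)) (onLayer-pairs {i = suc zero} {zero} (inj₂ refl) μ) ⟩
        (α ◂ (α₁′ ◂ r₁)) ⊕ onLayer zero μ               ≈⟨ merge ⟩
        (α ⊕ μ) ◂ (α₁′ ◂ r₁)                            ≲⟨ ⇝-◂ʳ α₁′◂r₁⇝α₂◂r₁ ⟩
        (α ⊕ μ) ◂ (α₂ ◂ r₁)                             ∎

    coverWithReserve : ∀ n k (d : Distribution (Layers (suc n))) →
      ReserveBound n k d → CoverWithReserve n k d
    coverWithReserve-◂ : ∀ n k α (d : Distribution (Layers n)) →
      (γ + k) * 2 ^ suc n ≤ ‖ α ‖ + size (Layers n) d + γ → CoverWithReserve n k (α ◂ d)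

    coverWithReserve n k d bound =
      coverWithReserve-resp {k = k} (head◂tail d) (coverWithReserve-◂ n k (head d) (tail d) bound′)
      where
      bound′ : (γ + k) * 2 ^ suc n ≤ ‖ head d ‖ + size (Layers n) (tail d) + γ
      bound′ = subst ((γ + k) * 2 ^ suc n ≤_) (cong (_+ γ) size-d) bound
        where
        size-d : size (Layers (suc n)) d ≡ ‖ head d ‖ + size (Layers n) (tail d)
        size-d = trans (size-cong (Layers (suc n)) (head◂tail d)) (size-◂ (head d) (tail d))

    coverWithReserve-◂ zero k α d bound =
      α , d , ⇝-reflexive (λ _ → refl) , one-layer-bound bound , λ { (() , _) }
    coverWithReserve-◂ (suc n) k α d bound with γ + 2 * k ≤? ‖ α ‖
    ... | yes enough = surplus-step (coverWithReserve n 0) enough bound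
    ... | no short = deficit-step (coverWithReserve n) (≰⇒> short) bound

    coverSolvable-Layers : (n : ℕ) → CoverSolvable (Layers (suc n)) (γ * (2 ^ suc n ∸ 1))
    coverSolvable-Layers n d ‖d‖≡N
      with coverWithReserve n 0 d
             (subst ((γ + 0) * 2 ^ suc n ≤_) (cong (_+ γ) (sym ‖d‖≡N)) (initial-bound γ (suc n)))
    ... | α , r , d⇝α◂r , γ≤‖α‖ , r-cover with cover-layer (≤-trans (m≤m+n γ 0) γ≤‖α‖) r-cover
    ... | α′ , α◂r⇝α′◂r , cover = ⇝-cover (⇝-trans d⇝α◂r α◂r⇝α′◂r) cover

corollary2p5 : (G : Graph) → IsFiniteSimpleConnected G →
    (n : ℕ) → 1 ≤ n →
    (γG γPG : ℕ) →
    IsCoverPebblingNumber G γG →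
    IsCoverPebblingNumber (Path n □ G) γPG →
    γPG ≤ γG * (2 ^ n ∸ 1)
corollary2p5 G fsc (suc n) _ γG γPG (solvable , _) (_ , minimal) =
  minimal (γG * (2 ^ suc n ∸ 1)) (FiniteGraph.coverSolvable-Layers G fsc solvable n)
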